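{- Let $\Gamma$ be a homogeneous 3-dimensional permutation structure. Then $\Gamma$ does not have two incomparable (under inclusion) equivalence relations definable without parameters.
   Context: A 3-dimensional permutation structure is a set with three linear orders; homogeneous means countable with every isomorphism between finite substructures extending to an automorphism. -}

module Defs where

open import Level using (0ℓ)
open import Data.Nat using (ℕ)
open import Data.Fin using (Fin; zero; suc)
open import Data.Product using (Σ; _×_; _,_; ∃)
open import Data.Sum using (_⊎_)
open import Data.Empty using (⊥)
open import Relation.Nullary using (¬_)
open import Relation.Binary.PropositionalEquality using (_≡_)
open import Relation.Binary.Structures using (IsStrictTotalOrder; IsEquivalence)
open import Function.Definitions using (Injective)
open import Function.Bundles using (_⇔_; _↔_; Inverse)

record Perm3 : Set₁ where
  field
    Carrier : Set
    ord     : Fin 3 → Carrier → Carrier → Set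
    isSTO   : (k : Fin 3) → IsStrictTotalOrder _≡_ (ord k)

open Perm3 public

Countable : Perm3 → Set
Countable Γ = Σ (Carrier Γ → ℕ) λ f → Injective _≡_ _≡_ f

record Automorphism (Γ : Perm3) : Set where
  field
    bij      : Carrier Γ ↔ Carrier Γ
    preserve : ∀ (k : Fin 3) x y →
               ord Γ k x y ⇔ ord Γ k (Inverse.to bij x) (Inverse.to bij y)

-- A finite partial isomorphism, given by two n-tuples a, b with
-- a i ↦ b i; being an isomorphism of the induced finite substructures
-- means all order relations are preserved and reflected (well-definedness
-- and injectivity of a i ↦ b i follow from the orders being linear).
IsFinPartialIso : (Γ : Perm3) (n : ℕ) (a b : Fin n → Carrier Γ) → Set
IsFinPartialIso Γ n a b = ∀ (k : Fin 3) (i j : Fin n) → ord Γ k (a i) (a j) ⇔ ord Γ k (b i) (b j)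

Homogeneous : Perm3 → Set
Homogeneous Γ =
  Countable Γ ×
  (∀ (n : ℕ) (a b : Fin n → Carrier Γ) → IsFinPartialIso Γ n a b →
     Σ (Automorphism Γ) λ σ → ∀ i → Inverse.to (Automorphism.bij σ) (a i) ≡ b i)

data Formula : ℕ → Set where
  _≐_   : ∀ {n} → Fin n → Fin n → Formula n
  rel   : ∀ {n} → Fin 3 → Fin n → Fin n → Formula n
  ⊤f ⊥f : ∀ {n} → Formula n
  ¬f_   : ∀ {n} → Formula n → Formula n
  _∧f_ _∨f_ _⇒f_ : ∀ {n} → Formula n → Formula n → Formula n
  ∀f ∃f : ∀ {n} → Formula (ℕ.suc n) → Formula n

extend : ∀ {A : Set} {n} → A → (Fin n → A) → Fin (ℕ.suc n) → A
extend x ρ zero    = x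
extend x ρ (suc i) = ρ i

record ⊤′ : Set where

Sat : (Γ : Perm3) → ∀ {n} → Formula n → (Fin n → Carrier Γ) → Set
Sat Γ (i ≐ j)     ρ = ρ i ≡ ρ j
Sat Γ (rel k i j) ρ = ord Γ k (ρ i) (ρ j)
Sat Γ ⊤f          ρ = ⊤′
Sat Γ ⊥f          ρ = ⊥
Sat Γ (¬f φ)      ρ = ¬ Sat Γ φ ρ
Sat Γ (φ ∧f ψ)    ρ = Sat Γ φ ρ × Sat Γ ψ ρ
Sat Γ (φ ∨f ψ)    ρ = Sat Γ φ ρ ⊎ Sat Γ ψ ρ
Sat Γ (φ ⇒f ψ)    ρ = Sat Γ φ ρ → Sat Γ ψ ρ
Sat Γ (∀f φ)      ρ = ∀ x → Sat Γ φ (extend x ρ)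
Sat Γ (∃f φ)      ρ = Σ (Carrier Γ) λ x → Sat Γ φ (extend x ρ)

pair : ∀ {A : Set} → A → A → Fin 2 → A
pair x y zero    = x
pair x y (suc _) = y

DefRel : (Γ : Perm3) → Formula 2 → Carrier Γ → Carrier Γ → Set
DefRel Γ φ x y = Sat Γ φ (pair x y)

DefinesEquivalence : (Γ : Perm3) → Formula 2 → Set
DefinesEquivalence Γ φ = IsEquivalence (DefRel Γ φ)

_⊆R_ : ∀ {A : Set} → (A → A → Set) → (A → A → Set) → Set
R ⊆R S = ∀ x y → R x y → S x y

HasTwoIncomparableDefEqRels : Perm3 → Set
HasTwoIncomparableDefEqRels Γ =
  Σ (Formula 2) λ φ → Σ (Formula 2) λ ψ →
    DefinesEquivalence Γ φ × DefinesEquivalence Γ ψ ×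
    ¬ (DefRel Γ φ ⊆R DefRel Γ ψ) × ¬ (DefRel Γ ψ ⊆R DefRel Γ φ)

-- Automorphisms preserve ∅-definable relations, and in a homogeneous
-- structure two pairs of distinct points of the same order type (oriented
-- alike in each of the three orders) are conjugate by an automorphism, so no
-- ∅-definable relation separates them.  Suppose φ, ψ are incomparable
-- definable equivalences, with φ(a,b) ∧ ¬ψ(a,b) and ψ(u,v) ∧ ¬φ(u,v).  As
-- there are only three orders, (a,b) is oriented like (u,v), or like (v,u),
-- in at least two of them; by symmetry of ψ, φ and transitivity of the
-- automorphism group we get c with ψ(b,c) ∧ ¬φ(b,c) such that (a,b) and
-- (b,c) agree in all orders but one, m.  Where a<b ⇔ b<c, the pair (a,c) is
-- oriented like (a,b) and like (b,c); in order m it is oriented like one of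
-- them.  So (a,c) has the type of (a,b), whence φ(a,c), or of (b,c), whence
-- ψ(a,c); both contradict transitivity.
--
-- Excluded middle is used only to extract witnesses of non-inclusion.

module Submission where

open import Defs
open import Level using (0ℓ)
open import Axiom.ExcludedMiddle using (ExcludedMiddle)
open import Axiom.DoubleNegationElimination using (em⇒dne)
open import Relation.Nullary using (¬_; yes; no)
open import Data.Fin using (Fin; zero; suc; _≟_)
open import Data.Fin.Patterns using (0F; 1F; 2F)
open import Data.Product using (Σ; _×_; _,_; proj₂; ∃-syntax)
open import Data.Product.Function.NonDependent.Propositional using (_×-⇔_)
open import Data.Sum using (_⊎_; inj₁; inj₂; [_,_])
open import Data.Sum.Function.Propositional using (_⊎-⇔_)
open import Data.Empty using (⊥; ⊥-elim)
open import Relation.Binary.PropositionalEquality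
  using (_≡_; _≢_; refl; sym; trans; cong; subst; subst₂)
open import Relation.Binary.Structures using (IsStrictTotalOrder; IsEquivalence)
open import Relation.Binary.Definitions using (tri<; tri≈; tri>)
open import Function.Bundles using (_⇔_; Inverse; Injection; mk⇔; Equivalence)
open import Function.Properties.Inverse using (↔⇒↣)
open import Function.Related.TypeIsomorphisms using (¬-cong-⇔; →-cong-⇔)
import Function.Properties.Equivalence as ⇔

act : {Γ : Perm3} → Automorphism Γ → Carrier Γ → Carrier Γ
act σ = Inverse.to (Automorphism.bij σ)

both-false : {P Q : Set} → ¬ P → ¬ Q → P ⇔ Q
both-false ¬p ¬q = mk⇔ (λ p → ⊥-elim (¬p p)) (λ q → ⊥-elim (¬q q))

module Invariance (Γ : Perm3) (σ : Automorphism Γ) where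
  open Inverse (Automorphism.bij σ) using (from; strictlyInverseˡ)
  open Automorphism σ using (preserve)

  _↦_ : ∀ {n} → (Fin n → Carrier Γ) → (Fin n → Carrier Γ) → Set
  ρ ↦ ρ′ = ∀ i → act σ (ρ i) ≡ ρ′ i

  ↦-extend : ∀ {n} {ρ ρ′ : Fin n → Carrier Γ} {x y} →
             act σ x ≡ y → ρ ↦ ρ′ → extend x ρ ↦ extend y ρ′
  ↦-extend x↦y ρ↦ρ′ zero    = x↦y
  ↦-extend x↦y ρ↦ρ′ (suc i) = ρ↦ρ′ i

  -- Induction on formulas; quantifiers use that σ is onto (∀) and total (∃).
  sat-invariant : ∀ {n} (φ : Formula n) {ρ ρ′} → ρ ↦ ρ′ → Sat Γ φ ρ ⇔ Sat Γ φ ρ′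
  sat-invariant (i ≐ j) ρ↦ρ′ = mk⇔
    (λ e → trans (sym (ρ↦ρ′ i)) (trans (cong (act σ) e) (ρ↦ρ′ j)))
    (λ e → Injection.injective (↔⇒↣ (Automorphism.bij σ))
             (trans (ρ↦ρ′ i) (trans e (sym (ρ↦ρ′ j)))))
  sat-invariant (rel k i j) {ρ} ρ↦ρ′ =
    subst₂ (λ x y → ord Γ k (ρ i) (ρ j) ⇔ ord Γ k x y) (ρ↦ρ′ i) (ρ↦ρ′ j)
      (preserve k (ρ i) (ρ j))
  sat-invariant ⊤f       ρ↦ρ′ = ⇔.refl
  sat-invariant ⊥f       ρ↦ρ′ = ⇔.refl
  sat-invariant (¬f φ)   ρ↦ρ′ = ¬-cong-⇔ (sat-invariant φ ρ↦ρ′)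
  sat-invariant (φ ∧f ψ) ρ↦ρ′ = sat-invariant φ ρ↦ρ′ ×-⇔ sat-invariant ψ ρ↦ρ′
  sat-invariant (φ ∨f ψ) ρ↦ρ′ = sat-invariant φ ρ↦ρ′ ⊎-⇔ sat-invariant ψ ρ↦ρ′
  sat-invariant (φ ⇒f ψ) ρ↦ρ′ = →-cong-⇔ (sat-invariant φ ρ↦ρ′) (sat-invariant ψ ρ↦ρ′)
  sat-invariant (∀f φ)   ρ↦ρ′ = mk⇔
    (λ p y → Equivalence.to (sat-invariant φ (↦-extend (strictlyInverseˡ y) ρ↦ρ′)) (p (from y)))
    (λ p x → Equivalence.from (sat-invariant φ (↦-extend refl ρ↦ρ′)) (p (act σ x)))
  sat-invariant (∃f φ)   ρ↦ρ′ = mk⇔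
    (λ (x , p) → act σ x , Equivalence.to (sat-invariant φ (↦-extend refl ρ↦ρ′)) p)
    (λ (y , p) → from y ,
       Equivalence.from (sat-invariant φ (↦-extend (strictlyInverseˡ y) ρ↦ρ′)) p)

  defRel-invariant : (φ : Formula 2) (x y : Carrier Γ) →
                     DefRel Γ φ x y ⇔ DefRel Γ φ (act σ x) (act σ y)
  defRel-invariant φ x y = sat-invariant φ λ { zero → refl ; (suc _) → refl }

module Orientation {A : Set} {_<_ : A → A → Set} (sto : IsStrictTotalOrder _≡_ _<_) where
  open IsStrictTotalOrder sto using (asym; compare; _<?_) renaming (trans to <-trans)

  connex : ∀ {x y} → x ≢ y → ¬ x < y → y < x
  connex {x} {y} x≢y x≮y with compare x y
  ... | tri< x<y _   _   = ⊥-elim (x≮y x<y)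
  ... | tri≈ _   x≡y _   = ⊥-elim (x≢y x≡y)
  ... | tri> _   _   y<x = y<x

  reverse : ∀ {x y x′ y′} → x ≢ y → x′ ≢ y′ → (x < y ⇔ x′ < y′) → (y < x ⇔ y′ < x′)
  reverse x≢y x′≢y′ same = mk⇔
    (λ y<x → connex x′≢y′ λ x′<y′ → asym y<x (Equivalence.from same x′<y′))
    (λ y′<x′ → connex x≢y λ x<y → asym y′<x′ (Equivalence.to same x<y))

  align : ∀ x y {x′ y′} → x′ ≢ y′ → (x < y ⇔ x′ < y′) ⊎ (x < y ⇔ y′ < x′)
  align x y {x′} {y′} x′≢y′ with x <? y | x′ <? y′
  ... | yes x<y | yes x′<y′ = inj₁ (mk⇔ (λ _ → x′<y′) (λ _ → x<y))
  ... | yes x<y | no  x′≮y′ = inj₂ (mk⇔ (λ _ → connex x′≢y′ x′≮y′) (λ _ → x<y))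
  ... | no  x≮y | yes x′<y′ = inj₂ (both-false x≮y (asym x′<y′))
  ... | no  x≮y | no  x′≮y′ = inj₁ (both-false x≮y x′≮y′)

  outer-orientation : ∀ {a b} c → a ≢ b → (a < c ⇔ a < b) ⊎ (a < c ⇔ b < c)
  outer-orientation {a} {b} c a≢b with a <? c | a <? b
  ... | yes a<c | yes a<b = inj₁ (mk⇔ (λ _ → a<b) (λ _ → a<c))
  ... | yes a<c | no  a≮b = inj₂ (mk⇔ (λ _ → <-trans (connex a≢b a≮b) a<c) (λ _ → a<c))
  ... | no  a≮c | yes a<b = inj₂ (both-false a≮c (λ b<c → a≮c (<-trans a<b b<c)))
  ... | no  a≮c | no  a≮b = inj₁ (both-false a≮c a≮b)

  outer-agrees : ∀ {a b c} → a ≢ b → (a < b ⇔ b < c) → (a < c ⇔ a < b)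
  outer-agrees {c = c} a≢b same with outer-orientation c a≢b
  ... | inj₁ likeAB = likeAB
  ... | inj₂ likeBC = ⇔.trans likeBC (⇔.sym same)

AllBut : (Fin 3 → Set) → Fin 3 → Set
AllBut P m = ∀ k → k ≢ m → P k

complete : ∀ {P m} → P m → AllBut P m → ∀ k → P k
complete {m = m} pm rest k with k ≟ m
... | yes refl = pm
... | no  k≢m  = rest k k≢m

but₀ : ∀ {R : Fin 3 → Set} → R 1F → R 2F → AllBut R 0F
but₀ r₁ r₂ 0F ne = ⊥-elim (ne refl)
but₀ r₁ r₂ 1F _  = r₁
but₀ r₁ r₂ 2F _  = r₂
but₁ : ∀ {R : Fin 3 → Set} → R 0F → R 2F → AllBut R 1F
but₁ r₀ r₂ 0F _  = r₀
but₁ r₀ r₂ 1F ne = ⊥-elim (ne refl)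
but₁ r₀ r₂ 2F _  = r₂
but₂ : ∀ {R : Fin 3 → Set} → R 0F → R 1F → AllBut R 2F
but₂ r₀ r₁ 0F _  = r₀
but₂ r₀ r₁ 1F _  = r₁
but₂ r₀ r₁ 2F ne = ⊥-elim (ne refl)

majority : ∀ {P Q : Fin 3 → Set} → (∀ k → P k ⊎ Q k) →
           (∃[ m ] AllBut P m) ⊎ (∃[ m ] AllBut Q m)
majority alt with alt 0F | alt 1F | alt 2F
... | inj₁ p₀ | inj₁ p₁ | _       = inj₁ (2F , but₂ p₀ p₁)
... | inj₁ p₀ | _       | inj₁ p₂ = inj₁ (1F , but₁ p₀ p₂)
... | _       | inj₁ p₁ | inj₁ p₂ = inj₁ (0F , but₀ p₁ p₂)
... | inj₂ q₀ | inj₂ q₁ | _       = inj₂ (2F , but₂ q₀ q₁)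
... | inj₂ q₀ | _       | inj₂ q₂ = inj₂ (1F , but₁ q₀ q₂)
... | _       | inj₂ q₁ | inj₂ q₂ = inj₂ (0F , but₀ q₁ q₂)

non-inclusion-witness : ExcludedMiddle 0ℓ → {A : Set} (R S : A → A → Set) →
                        ¬ (R ⊆R S) → ∃[ x ] ∃[ y ] R x y × ¬ S x y
non-inclusion-witness em R S R⊈S =
  dne λ none → R⊈S λ x y r → dne λ ¬s → none (x , y , r , ¬s)
  where dne = em⇒dne em

SameType : (Γ : Perm3) → Carrier Γ → Carrier Γ → Carrier Γ → Carrier Γ → Set
SameType Γ x y x′ y′ = ∀ k → ord Γ k x y ⇔ ord Γ k x′ y′

distinct : ∀ Γ φ {x y} → DefinesEquivalence Γ φ → ¬ DefRel Γ φ x y → x ≢ y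
distinct Γ φ {x} eq ¬xy x≡y = ¬xy (subst (DefRel Γ φ x) x≡y (IsEquivalence.refl eq))

module Homogeneity (Γ : Perm3) (hom : Homogeneous Γ) where
  private
    C : Set
    C = Carrier Γ
    module O (k : Fin 3) = Orientation (isSTO Γ k)

    extend-iso : ∀ n (a b : Fin n → C) → IsFinPartialIso Γ n a b →
                 Σ (Automorphism Γ) λ σ → ∀ i → act σ (a i) ≡ b i
    extend-iso = proj₂ hom

    irrefl : ∀ k {x} → ¬ ord Γ k x x
    irrefl k = IsStrictTotalOrder.irrefl (isSTO Γ k) refl

  transitive : (u b : C) → Σ (Automorphism Γ) λ τ → act τ u ≡ b
  transitive u b with extend-iso 1 (λ _ → u) (λ _ → b) (λ k _ _ → both-false (irrefl k) (irrefl k))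
  ... | τ , τu≡b = τ , τu≡b 0F

  conjugate : ∀ {x y x′ y′} → x ≢ y → x′ ≢ y′ → SameType Γ x y x′ y′ →
              Σ (Automorphism Γ) λ σ → act σ x ≡ x′ × act σ y ≡ y′
  conjugate {x} {y} {x′} {y′} x≢y x′≢y′ same with extend-iso 2 (pair x y) (pair x′ y′) iso
    where
    iso : IsFinPartialIso Γ 2 (pair x y) (pair x′ y′)
    iso k 0F 0F = both-false (irrefl k) (irrefl k)
    iso k 0F 1F = same k
    iso k 1F 0F = O.reverse k x≢y x′≢y′ (same k)
    iso k 1F 1F = both-false (irrefl k) (irrefl k)
  ... | σ , σ-maps = σ , σ-maps 0F , σ-maps 1F

  transport : ∀ φ {x y x′ y′} → x ≢ y → x′ ≢ y′ → SameType Γ x y x′ y′ →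
              DefRel Γ φ x y → DefRel Γ φ x′ y′
  transport φ {x} {y} x≢y x′≢y′ same φxy with conjugate x≢y x′≢y′ same
  ... | σ , refl , refl = Equivalence.to (Invariance.defRel-invariant Γ σ φ x y) φxy

  relocate : (u v b : C) → ∃[ c ] SameType Γ u v b c × (∀ φ → DefRel Γ φ u v ⇔ DefRel Γ φ b c)
  relocate u v b with transitive u b
  ... | τ , refl = act τ v , (λ k → Automorphism.preserve τ k u v) ,
                   λ φ → Invariance.defRel-invariant Γ τ φ u v

module NoCrossing (Γ : Perm3) (hom : Homogeneous Γ) (φ ψ : Formula 2)
                  (eqφ : DefinesEquivalence Γ φ) (eqψ : DefinesEquivalence Γ ψ) where
  open Homogeneity Γ hom
  private
    module Eφ = IsEquivalence eqφ
    module Eψ = IsEquivalence eqψ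
    module O (k : Fin 3) = Orientation (isSTO Γ k)
    _~φ_ _~ψ_ : Carrier Γ → Carrier Γ → Set
    _~φ_ = DefRel Γ φ
    _~ψ_ = DefRel Γ ψ

  -- (a,b) separates φ from ψ, (b,c) separates ψ from φ, and the two pairs
  -- are oriented alike off m: then (a,c) has the type of one of them,
  -- forcing a ~φ c or a ~ψ c, which transitivity forbids.
  no-triangle : ∀ {a b c} m → a ~φ b → ¬ a ~ψ b → b ~ψ c → ¬ b ~φ c →
                AllBut (λ k → ord Γ k a b ⇔ ord Γ k b c) m → ⊥
  no-triangle {a} {b} {c} m a~φb a≁ψb b~ψc b≁φc agree =
    [ likeAB⇒⊥ , likeBC⇒⊥ ] (O.outer-orientation m c a≢b)
    where
    a≢b : a ≢ b
    a≢b = distinct Γ ψ eqψ a≁ψb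
    b≢c : b ≢ c
    b≢c = distinct Γ φ eqφ b≁φc
    a≁φc : ¬ a ~φ c
    a≁φc a~φc = b≁φc (Eφ.trans (Eφ.sym a~φb) a~φc)
    a≁ψc : ¬ a ~ψ c
    a≁ψc a~ψc = a≁ψb (Eψ.trans a~ψc (Eψ.sym b~ψc))
    a≢c : a ≢ c
    a≢c = distinct Γ φ eqφ a≁φc

    likeAB-off-m : AllBut (λ k → ord Γ k a c ⇔ ord Γ k a b) m
    likeAB-off-m k k≢m = O.outer-agrees k a≢b (agree k k≢m)

    likeAB⇒⊥ : (ord Γ m a c ⇔ ord Γ m a b) → ⊥
    likeAB⇒⊥ likeAB = a≁φc (transport φ a≢b a≢c (λ k → ⇔.sym (typeAC k)) a~φb)
      where
      typeAC : SameType Γ a c a b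
      typeAC = complete likeAB likeAB-off-m

    likeBC⇒⊥ : (ord Γ m a c ⇔ ord Γ m b c) → ⊥
    likeBC⇒⊥ likeBC = a≁ψc (transport ψ b≢c a≢c (λ k → ⇔.sym (typeAC k)) b~ψc)
      where
      typeAC : SameType Γ a c b c
      typeAC = complete likeBC λ k k≢m → ⇔.trans (likeAB-off-m k k≢m) (agree k k≢m)

  -- If (u,v) separates ψ from φ and is oriented like (a,b) off m, moving it
  -- to start at b produces a forbidden triangle.
  aligned-crossing : ∀ {a b u v} m → a ~φ b → ¬ a ~ψ b → u ~ψ v → ¬ u ~φ v →
                     AllBut (λ k → ord Γ k a b ⇔ ord Γ k u v) m → ⊥
  aligned-crossing {b = b} {u} {v} m a~φb a≁ψb u~ψv u≁φv agree
    with relocate u v b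
  ... | c , sameType , sameRels =
    no-triangle m a~φb a≁ψb (Equivalence.to (sameRels ψ) u~ψv)
      (λ b~φc → u≁φv (Equivalence.from (sameRels φ) b~φc))
      (λ k k≢m → ⇔.trans (agree k k≢m) (sameType k))

  -- No pair separating φ from ψ coexists with one separating ψ from φ:
  -- by majority, (a,b) is oriented like (u,v) or like (v,u) off some m.
  no-crossing : ∀ {a b u v} → a ~φ b → ¬ a ~ψ b → u ~ψ v → ¬ u ~φ v → ⊥
  no-crossing {a} {b} {u} {v} a~φb a≁ψb u~ψv u≁φv
    with majority (λ k → O.align k a b (distinct Γ φ eqφ u≁φv))
  ... | inj₁ (m , like-uv) = aligned-crossing m a~φb a≁ψb u~ψv u≁φv like-uv
  ... | inj₂ (m , like-vu) =
    aligned-crossing m a~φb a≁ψb (Eψ.sym u~ψv) (λ v~φu → u≁φv (Eφ.sym v~φu)) like-vu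

mainTheorem19 : ExcludedMiddle 0ℓ → (Γ : Perm3) → Homogeneous Γ →
    ¬ HasTwoIncomparableDefEqRels Γ
mainTheorem19 em Γ hom (φ , ψ , eqφ , eqψ , φ⊈ψ , ψ⊈φ)
  with non-inclusion-witness em _ _ φ⊈ψ | non-inclusion-witness em _ _ ψ⊈φ
... | a , b , a~φb , a≁ψb | u , v , u~ψv , u≁φv =
  NoCrossing.no-crossing Γ hom φ ψ eqφ eqψ a~φb a≁ψb u~ψv u≁φv
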